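{- Let $t,t'$ be terms and $\pi'$ a derivation with conclusion $\Gamma\vdash t'\colon Q$. (1) If $t\to_{\rhd\beta_v}t'$ then there exists a derivation $\pi$ with conclusion $\Gamma\vdash t\colon Q$ such that $|\pi|=|\pi'|+1$. (2) If $t\to_{\rhd\sigma}t'$ then $|\pi'|>0$ and there exists a derivation $\pi$ with conclusion $\Gamma\vdash t\colon Q$ such that $|\pi|=|\pi'|$.
   Context: Terms: $t ::= x \mid \lambda x.t \mid tu$ (up to $\alpha$); values $v ::= x \mid \lambda x.t$; $\mathrm{Fv}(t)$ free variables; $t\{v/x\}$ substitution. Root steps: ($\beta_v$) $(\lambda x.t)v \mapsto t\{v/x\}$, $v$ a value; ($\sigma_1$) $(\lambda x.t)us \mapsto (\lambda x.ts)u$ if $x\notin\mathrm{Fv}(s)$; ($\sigma_3$) $v((\lambda x.s)u)\mapsto(\lambda x.vs)u$ if $v$ a value, $x\notin\mathrm{Fv}(v)$. Balanced contexts $B ::= [\cdot] \mid (\lambda x.B)t \mid Bt \mid tB$; $\to_{\rhd r}$ is the closure of root step $r$ under balanced contexts; $\to_{\rhd\sigma}$ is the union of $\to_{\rhd\sigma_1}$ and $\to_{\rhd\sigma_3}$. Types: positive types are finite multisets $[(P_1,Q_1),\dots,(P_n,Q_n)]$ of pairs of positive types ($\mathbf{0}$ empty, $\uplus$ union). Environments map variables to positive types (finitely many non-$\mathbf{0}$), combined pointwise by $\uplus$. Rules: (ax) $x\colon P\vdash x\colon P$; ($\lambda$) from $\Gamma_i,x\colon P_i\vdash t\colon Q_i$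 ($1\le i\le n$, $n\ge0$) infer $\biguplus_i\Gamma_i\vdash\lambda x.t\colon[(P_1,Q_1),\dots,(P_n,Q_n)]$; ($@$) from $\Gamma\vdash t\colon[(P,Q)]$ and $\Delta\vdash u\colon P$ infer $\Gamma\uplus\Delta\vdash tu\colon Q$. The size $|\pi|$ of a derivation is the number of $@$ rules in it. -}

module Defs where

open import Data.Nat using (ℕ; zero; suc; _+_; _≡ᵇ_)
open import Data.Bool using (if_then_else_)

-- Terms (de Bruijn indices, i.e. terms up to α-equivalence)

data Term : Set where
  var : ℕ → Term
  lam : Term → Term
  app : Term → Term → Term

data Value : Term → Set where
  vvar : ∀ n → Value (var n)
  vlam : ∀ t → Value (lam t)

ext : (ℕ → ℕ) → ℕ → ℕ
ext ρ zero    = zero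
ext ρ (suc n) = suc (ρ n)

rename : (ℕ → ℕ) → Term → Term
rename ρ (var n)   = var (ρ n)
rename ρ (lam t)   = lam (rename (ext ρ) t)
rename ρ (app t u) = app (rename ρ t) (rename ρ u)

↑ : Term → Term
↑ = rename suc

exts : (ℕ → Term) → ℕ → Term
exts σ zero    = var zero
exts σ (suc n) = ↑ (σ n)

subst : (ℕ → Term) → Term → Term
subst σ (var n)   = σ n
subst σ (lam t)   = lam (subst (exts σ) t)
subst σ (app t u) = app (subst σ t) (subst σ u)

-- t{v/x} where x is the variable bound by the enclosing λ (index 0)
single : Term → ℕ → Term
single v zero    = v
single v (suc n) = var n

_[_] : Term → Term → Term
t [ v ] = subst (single v) t

-- Root steps (freshness side conditions are automatic with ↑)

data _↦βv_ : Term → Term → Set where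
  βv : ∀ {t v} → Value v → app (lam t) v ↦βv (t [ v ])

data _↦σ_ : Term → Term → Set where
  σ₁ : ∀ {t u s} → app (app (lam t) u) s ↦σ app (lam (app t (↑ s))) u
  σ₃ : ∀ {v s u} → Value v → app v (app (lam s) u) ↦σ app (lam (app (↑ v) s)) u

-- closure under balanced contexts  B ::= [·] | (λx.B)t | Bt | tB
data Bal (R : Term → Term → Set) : Term → Term → Set where
  root  : ∀ {t t'} → R t t' → Bal R t t'
  inLam : ∀ {t t' s} → Bal R t t' → Bal R (app (lam t) s) (app (lam t') s)
  appL  : ∀ {t t' s} → Bal R t t' → Bal R (app t s) (app t' s)
  appR  : ∀ {t t' s} → Bal R t t' → Bal R (app s t) (app s t')

_→βv_ : Term → Term → Set
_→βv_ = Bal _↦βv_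

_→σ_ : Term → Term → Set
_→σ_ = Bal _↦σ_

-- Positive types: finite multisets of pairs of positive types,
-- represented by lists, with multiset equality _≈_ (nested).

data Pos : Set where
  𝟎    : Pos
  ⟨_,_⟩∷_ : Pos → Pos → Pos → Pos

[_,_] : Pos → Pos → Pos
[ P , Q ] = ⟨ P , Q ⟩∷ 𝟎

_⊎_ : Pos → Pos → Pos
𝟎 ⊎ R = R
(⟨ P , Q ⟩∷ S) ⊎ R = ⟨ P , Q ⟩∷ (S ⊎ R)

infixr 5 _⊎_

data _≈_ : Pos → Pos → Set where
  ≈nil   : 𝟎 ≈ 𝟎
  ≈cons  : ∀ {P P' Q Q' R R'} → P ≈ P' → Q ≈ Q' → R ≈ R' →
           (⟨ P , Q ⟩∷ R) ≈ (⟨ P' , Q' ⟩∷ R')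
  ≈swap  : ∀ {P Q P' Q' R} →
           (⟨ P , Q ⟩∷ ⟨ P' , Q' ⟩∷ R) ≈ (⟨ P' , Q' ⟩∷ ⟨ P , Q ⟩∷ R)
  ≈trans : ∀ {P Q R} → P ≈ Q → Q ≈ R → P ≈ R

Env : Set
Env = ℕ → Pos

0ₑ : Env
0ₑ _ = 𝟎

_⊎ₑ_ : Env → Env → Env
(Γ ⊎ₑ Δ) n = Γ n ⊎ Δ n

-- Γ , x : P  for the variable bound by a new λ
_∷ₑ_ : Pos → Env → Env
(P ∷ₑ Γ) zero    = P
(P ∷ₑ Γ) (suc n) = Γ n

_↦ₑ_ : ℕ → Pos → Env
(x ↦ₑ P) y = if x ≡ᵇ y then P else 𝟎

_≈ₑ_ : Env → Env → Set
Γ ≈ₑ Δ = ∀ n → Γ n ≈ Δ n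

-- Derivations Γ ⊢ t : Q, with conclusions taken up to multiset equality

mutual
  data _⊢_∶_ : Env → Term → Pos → Set where
    ax  : ∀ {Γ x P Q} → Γ ≈ₑ (x ↦ₑ P) → Q ≈ P → Γ ⊢ var x ∶ Q
    λr  : ∀ {Γ Γ' t Q Q'} → LamPrems t Γ' Q' → Γ ≈ₑ Γ' → Q ≈ Q' →
          Γ ⊢ lam t ∶ Q
    appr  : ∀ {Γ Γ₁ Γ₂ t u P Q} → Γ₁ ⊢ t ∶ [ P , Q ] → Γ₂ ⊢ u ∶ P →
          Γ ≈ₑ (Γ₁ ⊎ₑ Γ₂) → Γ ⊢ app t u ∶ Q

  -- the n ≥ 0 premises Γᵢ , x : Pᵢ ⊢ t : Qᵢ of the λ rule, indexed by
  -- ⊎ᵢ Γᵢ and [(P₁,Q₁),…,(Pₙ,Qₙ)]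
  data LamPrems (t : Term) : Env → Pos → Set where
    pnil  : LamPrems t 0ₑ 𝟎
    pcons : ∀ {Γ Δ P Q R} → (P ∷ₑ Γ) ⊢ t ∶ Q → LamPrems t Δ R →
            LamPrems t (Γ ⊎ₑ Δ) (⟨ P , Q ⟩∷ R)

mutual
  size : ∀ {Γ t Q} → Γ ⊢ t ∶ Q → ℕ
  size (ax _ _)       = 0
  size (λr ps _ _)    = sizes ps
  size (appr π ρ _)     = suc (size π + size ρ)

  sizes : ∀ {t Γ Q} → LamPrems t Γ Q → ℕ
  sizes pnil         = 0
  sizes (pcons π ps) = size π + sizes ps

-- A derivation of t{v/x} splits into one of t, with x : P, and one of the
-- value v : P, with sizes adding up (anti-substitution).  This works because
-- the typings of a value are closed under ⊎ — the λ rule takes any number of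
-- premises, and v : 𝟎 has a derivation without any @ rule — so the copies of
-- v scattered through t{v/x} can be gathered into a single derivation.
-- Rebuilding (λx.t)v then costs exactly one @ rule.  A σ-step only moves the
-- same @ rules around; the variable of the moved λ does not occur in the
-- moved term, so its derivation can be strengthened.  Both expansions lift
-- through balanced contexts, since a derivation of (λx.B)s contains one of B.

module Submission where

open import Defs
open import Algebra.Bundles using (CommutativeSemigroup)
open import Algebra.Structures using (IsCommutativeSemigroup)
import Algebra.Properties.CommutativeSemigroup as CommutativeSemigroupProperties
open import Data.Bool using (true; false)
open import Data.Nat using (ℕ; zero; suc; _+_; _<_; _≡ᵇ_; s≤s; z≤n)
open import Data.Nat.Properties using (+-comm; +-assoc; +-identityʳ; +-commutativeSemigroup)
open import Data.Nat.Tactic.RingSolver using (solve-∀)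
open import Data.Product using (Σ; _×_; _,_; map₂)
open import Level using (0ℓ)
open import Relation.Binary.Bundles using (Setoid)
open import Relation.Binary.Structures using (IsEquivalence)
open import Relation.Binary.PropositionalEquality using (_≡_; refl; sym; trans; cong; cong₂; module ≡-Reasoning)
import Relation.Binary.Reasoning.Setoid as SetoidReasoning

open CommutativeSemigroupProperties +-commutativeSemigroup using () renaming (interchange to +-interchange)

≈-refl : ∀ {P} → P ≈ P
≈-refl {𝟎}            = ≈nil
≈-refl {⟨ P , Q ⟩∷ R} = ≈cons ≈-refl ≈-refl ≈-refl

≈-sym : ∀ {P Q} → P ≈ Q → Q ≈ P
≈-sym ≈nil          = ≈nil
≈-sym (≈cons p q r) = ≈cons (≈-sym p) (≈-sym q) (≈-sym r)
≈-sym ≈swap         = ≈swap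
≈-sym (≈trans p q)  = ≈trans (≈-sym q) (≈-sym p)

≈-isEquivalence : IsEquivalence _≈_
≈-isEquivalence = record { refl = ≈-refl ; sym = ≈-sym ; trans = ≈trans }

≈-setoid : Setoid 0ℓ 0ℓ
≈-setoid = record { isEquivalence = ≈-isEquivalence }

⊎-congʳ : ∀ {P P'} R → P ≈ P' → (P ⊎ R) ≈ (P' ⊎ R)
⊎-congʳ R ≈nil          = ≈-refl
⊎-congʳ R (≈cons p q r) = ≈cons p q (⊎-congʳ R r)
⊎-congʳ R ≈swap         = ≈swap
⊎-congʳ R (≈trans p q)  = ≈trans (⊎-congʳ R p) (⊎-congʳ R q)

⊎-congˡ : ∀ P {R R'} → R ≈ R' → (P ⊎ R) ≈ (P ⊎ R')
⊎-congˡ 𝟎              r = r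
⊎-congˡ (⟨ A , B ⟩∷ P) r = ≈cons ≈-refl ≈-refl (⊎-congˡ P r)

⊎-cong : ∀ {P P' R R'} → P ≈ P' → R ≈ R' → (P ⊎ R) ≈ (P' ⊎ R')
⊎-cong {P' = P'} {R = R} p r = ≈trans (⊎-congʳ R p) (⊎-congˡ P' r)

⊎-assoc : ∀ P R S → ((P ⊎ R) ⊎ S) ≈ (P ⊎ (R ⊎ S))
⊎-assoc 𝟎              R S = ≈-refl
⊎-assoc (⟨ A , B ⟩∷ P) R S = ≈cons ≈-refl ≈-refl (⊎-assoc P R S)

⊎-identityʳ : ∀ P → (P ⊎ 𝟎) ≈ P
⊎-identityʳ 𝟎              = ≈nil
⊎-identityʳ (⟨ A , B ⟩∷ P) = ≈cons ≈-refl ≈-refl (⊎-identityʳ P)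

⊎-∷ʳ : ∀ P A B R → (P ⊎ (⟨ A , B ⟩∷ R)) ≈ (⟨ A , B ⟩∷ (P ⊎ R))
⊎-∷ʳ 𝟎              A B R = ≈-refl
⊎-∷ʳ (⟨ C , D ⟩∷ P) A B R = ≈trans (≈cons ≈-refl ≈-refl (⊎-∷ʳ P A B R)) ≈swap

⊎-comm : ∀ P R → (P ⊎ R) ≈ (R ⊎ P)
⊎-comm 𝟎              R = ≈-sym (⊎-identityʳ R)
⊎-comm (⟨ A , B ⟩∷ P) R = ≈trans (≈cons ≈-refl ≈-refl (⊎-comm P R)) (≈-sym (⊎-∷ʳ R A B P))

⊎-isCommutativeSemigroup : IsCommutativeSemigroup _≈_ _⊎_
⊎-isCommutativeSemigroup = record
  { isSemigroup = record
    { isMagma = record { isEquivalence = ≈-isEquivalence ; ∙-cong = ⊎-cong }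
    ; assoc   = ⊎-assoc
    }
  ; comm = ⊎-comm
  }

⊎-commutativeSemigroup : CommutativeSemigroup 0ℓ 0ℓ
⊎-commutativeSemigroup = record { isCommutativeSemigroup = ⊎-isCommutativeSemigroup }

open CommutativeSemigroupProperties ⊎-commutativeSemigroup using ()
  renaming (interchange to ⊎-interchange; xy∙z≈xz∙y to ⊎-swapʳ)

𝟎≈⇒≡𝟎 : ∀ {R} → 𝟎 ≈ R → R ≡ 𝟎
𝟎≈⇒≡𝟎 ≈nil = refl
𝟎≈⇒≡𝟎 (≈trans p q) with 𝟎≈⇒≡𝟎 p
... | refl = 𝟎≈⇒≡𝟎 q

data Singleton (P Q : Pos) : Pos → Set where
  singleton : ∀ {P' Q'} → P ≈ P' → Q ≈ Q' → Singleton P Q ([ P' , Q' ])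

[,]≈⇒Singleton : ∀ {P Q R} → [ P , Q ] ≈ R → Singleton P Q R
[,]≈⇒Singleton (≈cons p q r) with 𝟎≈⇒≡𝟎 r
... | refl = singleton p q
[,]≈⇒Singleton (≈trans p q) with [,]≈⇒Singleton p
... | singleton p₁ q₁ with [,]≈⇒Singleton q
...   | singleton p₂ q₂ = singleton (≈trans p₁ p₂) (≈trans q₁ q₂)

≈ₑ-refl : ∀ {Γ} → Γ ≈ₑ Γ
≈ₑ-refl n = ≈-refl

≈ₑ-sym : ∀ {Γ Δ} → Γ ≈ₑ Δ → Δ ≈ₑ Γ
≈ₑ-sym e n = ≈-sym (e n)

≈ₑ-trans : ∀ {Γ Δ Θ} → Γ ≈ₑ Δ → Δ ≈ₑ Θ → Γ ≈ₑ Θ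
≈ₑ-trans e f n = ≈trans (e n) (f n)

⊎ₑ-cong : ∀ {Γ Γ' Δ Δ'} → Γ ≈ₑ Γ' → Δ ≈ₑ Δ' → (Γ ⊎ₑ Δ) ≈ₑ (Γ' ⊎ₑ Δ')
⊎ₑ-cong e f n = ⊎-cong (e n) (f n)

⊎ₑ-identityʳ : ∀ Γ → (Γ ⊎ₑ 0ₑ) ≈ₑ Γ
⊎ₑ-identityʳ Γ n = ⊎-identityʳ (Γ n)

tailₑ : Env → Env
tailₑ Γ n = Γ (suc n)

∷ₑ-cong : ∀ {P P' Γ Γ'} → P ≈ P' → Γ ≈ₑ Γ' → (P ∷ₑ Γ) ≈ₑ (P' ∷ₑ Γ')
∷ₑ-cong p e zero    = p
∷ₑ-cong p e (suc n) = e n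

∷ₑ-tailₑ : ∀ {P Γ} → P ≈ Γ 0 → (P ∷ₑ tailₑ Γ) ≈ₑ Γ
∷ₑ-tailₑ p zero    = p
∷ₑ-tailₑ p (suc n) = ≈-refl

∷ₑ-0ₑ : ∀ P → (P ∷ₑ 0ₑ) ≈ₑ (0 ↦ₑ P)
∷ₑ-0ₑ P zero    = ≈-refl
∷ₑ-0ₑ P (suc n) = ≈nil

↦ₑ-𝟎 : ∀ x → 0ₑ ≈ₑ (x ↦ₑ 𝟎)
↦ₑ-𝟎 x n with x ≡ᵇ n
... | true  = ≈nil
... | false = ≈nil

↦ₑ-⊎ : ∀ x A B → ((x ↦ₑ A) ⊎ₑ (x ↦ₑ B)) ≈ₑ (x ↦ₑ (A ⊎ B))
↦ₑ-⊎ x A B n with x ≡ᵇ n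
... | true  = ≈-refl
... | false = ≈nil

-- insertₑ k P Γ adds a variable of type P at index k, matching the renaming
-- punchIn k; padₑ k Δ is Δ seen from under k binders.

punchIn : ℕ → ℕ → ℕ
punchIn zero    = suc
punchIn (suc k) = ext (punchIn k)

insertₑ : ℕ → Pos → Env → Env
insertₑ zero    P Γ = P ∷ₑ Γ
insertₑ (suc k) P Γ = Γ 0 ∷ₑ insertₑ k P (tailₑ Γ)

padₑ : ℕ → Env → Env
padₑ zero    Δ = Δ
padₑ (suc k) Δ = 𝟎 ∷ₑ padₑ k Δ

insertₑ-cong : ∀ k {P P' Γ Γ'} → P ≈ P' → Γ ≈ₑ Γ' → insertₑ k P Γ ≈ₑ insertₑ k P' Γ'
insertₑ-cong zero    p e = ∷ₑ-cong p e
insertₑ-cong (suc k) p e = ∷ₑ-cong (e 0) (insertₑ-cong k p (λ n → e (suc n)))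

insertₑ-⊎ₑ : ∀ k P₁ P₂ Γ₁ Γ₂ →
  insertₑ k (P₁ ⊎ P₂) (Γ₁ ⊎ₑ Γ₂) ≈ₑ (insertₑ k P₁ Γ₁ ⊎ₑ insertₑ k P₂ Γ₂)
insertₑ-⊎ₑ zero    P₁ P₂ Γ₁ Γ₂ zero    = ≈-refl
insertₑ-⊎ₑ zero    P₁ P₂ Γ₁ Γ₂ (suc n) = ≈-refl
insertₑ-⊎ₑ (suc k) P₁ P₂ Γ₁ Γ₂ zero    = ≈-refl
insertₑ-⊎ₑ (suc k) P₁ P₂ Γ₁ Γ₂ (suc n) = insertₑ-⊎ₑ k P₁ P₂ (tailₑ Γ₁) (tailₑ Γ₂) n

insertₑ-0ₑ : ∀ k → insertₑ k 𝟎 0ₑ ≈ₑ 0ₑ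
insertₑ-0ₑ zero    zero    = ≈nil
insertₑ-0ₑ zero    (suc n) = ≈nil
insertₑ-0ₑ (suc k) zero    = ≈nil
insertₑ-0ₑ (suc k) (suc n) = insertₑ-0ₑ k n

insertₑ-↦ₑ : ∀ k x P → insertₑ k 𝟎 (x ↦ₑ P) ≈ₑ (punchIn k x ↦ₑ P)
insertₑ-↦ₑ zero    x       P zero    = ≈nil
insertₑ-↦ₑ zero    x       P (suc n) = ≈-refl
insertₑ-↦ₑ (suc k) zero    P zero    = ≈-refl
insertₑ-↦ₑ (suc k) zero    P (suc n) = insertₑ-0ₑ k n
insertₑ-↦ₑ (suc k) (suc x) P zero    = ≈nil
insertₑ-↦ₑ (suc k) (suc x) P (suc n) = insertₑ-↦ₑ k x P n

padₑ-⊎ₑ : ∀ k Δ₁ Δ₂ → padₑ k (Δ₁ ⊎ₑ Δ₂) ≈ₑ (padₑ k Δ₁ ⊎ₑ padₑ k Δ₂)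
padₑ-⊎ₑ zero    Δ₁ Δ₂         = ≈ₑ-refl
padₑ-⊎ₑ (suc k) Δ₁ Δ₂ zero    = ≈nil
padₑ-⊎ₑ (suc k) Δ₁ Δ₂ (suc n) = padₑ-⊎ₑ k Δ₁ Δ₂ n

padₑ-0ₑ : ∀ k → padₑ k 0ₑ ≈ₑ 0ₑ
padₑ-0ₑ zero            = ≈ₑ-refl
padₑ-0ₑ (suc k) zero    = ≈nil
padₑ-0ₑ (suc k) (suc n) = padₑ-0ₑ k n

infix 2 _⊢_∶_#_

_⊢_∶_#_ : Env → Term → Pos → ℕ → Set
Γ ⊢ t ∶ Q # n = Σ (Γ ⊢ t ∶ Q) (λ π → size π ≡ n)

conv : ∀ {Γ Γ' t Q Q'} → Γ' ≈ₑ Γ → Q ≈ Q' → (π : Γ ⊢ t ∶ Q) → Γ' ⊢ t ∶ Q' # size π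
conv Γ'≈Γ Q≈Q' (ax e q)     = ax (≈ₑ-trans Γ'≈Γ e) (≈trans (≈-sym Q≈Q') q) , refl
conv Γ'≈Γ Q≈Q' (λr ps e q)  = λr ps (≈ₑ-trans Γ'≈Γ e) (≈trans (≈-sym Q≈Q') q) , refl
conv Γ'≈Γ Q≈Q' (appr π ρ e) with conv ≈ₑ-refl (≈cons ≈-refl Q≈Q' ≈nil) π
... | π' , s = appr π' ρ (≈ₑ-trans Γ'≈Γ e) , cong (λ n → suc (n + size ρ)) s

sole-premise : ∀ {a Γ Γ' P Q R} (ps : LamPrems a Γ' R) → Γ ≈ₑ Γ' → Singleton P Q R →
  (P ∷ₑ Γ) ⊢ a ∶ Q # sizes ps
sole-premise (pcons π pnil) Γ≈ (singleton p q) =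
  map₂ (λ s → trans s (sym (+-identityʳ _)))
       (conv (∷ₑ-cong p (≈ₑ-trans Γ≈ (⊎ₑ-identityʳ _))) (≈-sym q) π)

lam-inversion : ∀ {Γ a P Q} (π : Γ ⊢ lam a ∶ [ P , Q ]) → (P ∷ₑ Γ) ⊢ a ∶ Q # size π
lam-inversion (λr ps e q) = sole-premise ps e ([,]≈⇒Singleton q)

lam-intro : ∀ {Γ a P Q} (ρ : (P ∷ₑ Γ) ⊢ a ∶ Q) → Γ ⊢ lam a ∶ [ P , Q ] # size ρ
lam-intro {Γ} ρ = λr (pcons ρ pnil) (≈ₑ-sym (⊎ₑ-identityʳ Γ)) ≈-refl , +-identityʳ _

lam-intro-tailₑ : ∀ {Θ a P Q} → P ≈ Θ 0 → (ρ : Θ ⊢ a ∶ Q) → tailₑ Θ ⊢ lam a ∶ [ P , Q ] # size ρ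
lam-intro-tailₑ P≈ ρ with conv (∷ₑ-tailₑ P≈) ≈-refl ρ
... | ρ' , s = map₂ (λ s' → trans s' s) (lam-intro ρ')

mutual
  weaken : ∀ k {Γ t Q} (π : Γ ⊢ t ∶ Q) → insertₑ k 𝟎 Γ ⊢ rename (punchIn k) t ∶ Q # size π
  weaken k (ax {x = x} {P = P} e q) =
    ax (≈ₑ-trans (insertₑ-cong k ≈-refl e) (insertₑ-↦ₑ k x P)) q , refl
  weaken k (λr ps e q) with weakenPrems k ps
  ... | Θ , ps' , Θ≈ , s = λr ps' (≈ₑ-trans (insertₑ-cong k ≈-refl e) (≈ₑ-sym Θ≈)) q , s
  weaken k (appr {Γ₁ = Γ₁} {Γ₂ = Γ₂} π₁ π₂ e) with weaken k π₁ | weaken k π₂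
  ... | π₁' , s₁ | π₂' , s₂ =
    appr π₁' π₂' (≈ₑ-trans (insertₑ-cong k ≈-refl e) (insertₑ-⊎ₑ k 𝟎 𝟎 Γ₁ Γ₂)) ,
    cong₂ (λ m n → suc (m + n)) s₁ s₂

  weakenPrems : ∀ k {t Γ R} (ps : LamPrems t Γ R) →
    Σ Env λ Θ → Σ (LamPrems (rename (punchIn (suc k)) t) Θ R) λ ps' →
      (Θ ≈ₑ insertₑ k 𝟎 Γ) × (sizes ps' ≡ sizes ps)
  weakenPrems k pnil = 0ₑ , pnil , ≈ₑ-sym (insertₑ-0ₑ k) , refl
  weakenPrems k (pcons {Γ = Γ} {Δ = Δ} π ps) with weaken (suc k) π | weakenPrems k ps
  ... | π' , s₁ | Θ , ps' , Θ≈ , s₂ =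
    (insertₑ k 𝟎 Γ ⊎ₑ Θ) , pcons π' ps' ,
    ≈ₑ-trans (⊎ₑ-cong ≈ₑ-refl Θ≈) (≈ₑ-sym (insertₑ-⊎ₑ k 𝟎 𝟎 Γ Δ)) , cong₂ _+_ s₁ s₂

mutual
  strengthen : ∀ k {Γ t Q} (π : Γ ⊢ rename (punchIn k) t ∶ Q) →
    Σ Env λ Γ' → (Γ ≈ₑ insertₑ k 𝟎 Γ') × (Γ' ⊢ t ∶ Q # size π)
  strengthen k {t = var x} (ax {P = P} e q) =
    (x ↦ₑ P) , ≈ₑ-trans e (≈ₑ-sym (insertₑ-↦ₑ k x P)) , ax ≈ₑ-refl q , refl
  strengthen k {t = lam t} (λr ps e q) with strengthenPrems k ps
  ... | Θ , R' , ps' , Θ≈ , R≈ , s = Θ , ≈ₑ-trans e Θ≈ , λr ps' ≈ₑ-refl (≈trans q R≈) , s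
  strengthen k {t = app a b} (appr π₁ π₂ e) with strengthen k π₁ | strengthen k π₂
  ... | Γ₁ , Γ₁≈ , π₁' , s₁ | Γ₂ , Γ₂≈ , π₂' , s₂ =
    (Γ₁ ⊎ₑ Γ₂) ,
    ≈ₑ-trans e (≈ₑ-trans (⊎ₑ-cong Γ₁≈ Γ₂≈) (≈ₑ-sym (insertₑ-⊎ₑ k 𝟎 𝟎 Γ₁ Γ₂))) ,
    appr π₁' π₂' ≈ₑ-refl , cong₂ (λ m n → suc (m + n)) s₁ s₂

  strengthenPrems : ∀ k {t Γ R} (ps : LamPrems (rename (punchIn (suc k)) t) Γ R) →
    Σ Env λ Θ → Σ Pos λ R' → Σ (LamPrems t Θ R') λ ps' →
      (Γ ≈ₑ insertₑ k 𝟎 Θ) × (R ≈ R') × (sizes ps' ≡ sizes ps)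
  strengthenPrems k pnil = 0ₑ , 𝟎 , pnil , ≈ₑ-sym (insertₑ-0ₑ k) , ≈nil , refl
  strengthenPrems k (pcons {Q = Q} π ps) with strengthen (suc k) π | strengthenPrems k ps
  ... | Γ , Γ≈ , π' , s₁ | Θ , R' , ps' , Θ≈ , R≈ , s₂ with conv (∷ₑ-tailₑ ≈-refl) ≈-refl π'
  ... | π'' , s₀ =
    (tailₑ Γ ⊎ₑ Θ) , (⟨ Γ 0 , Q ⟩∷ R') , pcons π'' ps' ,
    ≈ₑ-trans (⊎ₑ-cong (λ n → Γ≈ (suc n)) Θ≈) (≈ₑ-sym (insertₑ-⊎ₑ k 𝟎 𝟎 (tailₑ Γ) Θ)) ,
    ≈cons (Γ≈ 0) ≈-refl R≈ , cong₂ _+_ (trans s₀ s₁) s₂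

value-𝟎 : ∀ {v} → Value v → 0ₑ ⊢ v ∶ 𝟎 # 0
value-𝟎 (vvar x) = ax (↦ₑ-𝟎 x) ≈nil , refl
value-𝟎 (vlam t) = λr pnil ≈ₑ-refl ≈nil , refl

LamPrems-⊎ : ∀ {t Γ₁ Γ₂ R₁ R₂} (ps₁ : LamPrems t Γ₁ R₁) (ps₂ : LamPrems t Γ₂ R₂) →
  Σ Env λ Θ → Σ (LamPrems t Θ (R₁ ⊎ R₂)) λ ps →
    (Θ ≈ₑ (Γ₁ ⊎ₑ Γ₂)) × (sizes ps ≡ sizes ps₁ + sizes ps₂)
LamPrems-⊎ pnil ps₂ = _ , ps₂ , ≈ₑ-refl , refl
LamPrems-⊎ {Γ₂ = Γ₂} (pcons {Γ = Γ} {Δ = Δ} π ps) ps₂ with LamPrems-⊎ ps ps₂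
... | Θ , ps' , Θ≈ , s =
  _ , pcons π ps' ,
  (λ n → ≈trans (⊎-congˡ (Γ n) (Θ≈ n)) (≈-sym (⊎-assoc (Γ n) (Δ n) (Γ₂ n)))) ,
  trans (cong (size π +_) s) (sym (+-assoc (size π) (sizes ps) (sizes ps₂)))

value-⊎ : ∀ {v Δ₁ Δ₂ P₁ P₂} → Value v → (π₁ : Δ₁ ⊢ v ∶ P₁) (π₂ : Δ₂ ⊢ v ∶ P₂) →
  (Δ₁ ⊎ₑ Δ₂) ⊢ v ∶ (P₁ ⊎ P₂) # size π₁ + size π₂
value-⊎ (vvar x) (ax e₁ q₁) (ax e₂ q₂) =
  ax (≈ₑ-trans (⊎ₑ-cong e₁ e₂) (↦ₑ-⊎ x _ _)) (⊎-cong q₁ q₂) , refl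
value-⊎ (vlam t) (λr ps₁ e₁ q₁) (λr ps₂ e₂ q₂) with LamPrems-⊎ ps₁ ps₂
... | Θ , ps , Θ≈ , s = λr ps (≈ₑ-trans (⊎ₑ-cong e₁ e₂) (≈ₑ-sym Θ≈)) (⊎-cong q₁ q₂) , s

-- Anti-substitution is proved under k binders, where the substituted
-- variable has index k and v is shifted by k.

singleAt : Term → ℕ → ℕ → Term
singleAt v zero    = single v
singleAt v (suc k) = exts (singleAt v k)

record AntiSubst (k : ℕ) (v t : Term) (Γ : Env) (Q : Pos) (n : ℕ) : Set where
  constructor antiSubst
  field
    Γₜ Γᵥ     : Env
    P         : Pos
    πₜ        : insertₑ k P Γₜ ⊢ t ∶ Q
    πᵥ        : Γᵥ ⊢ v ∶ P
    split     : Γ ≈ₑ (Γₜ ⊎ₑ padₑ k Γᵥ)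
    sizes-add : n ≡ size πₜ + size πᵥ

record AntiSubstPrems (k : ℕ) (v t : Term) (Γ : Env) (R : Pos) (n : ℕ) : Set where
  constructor antiSubstPrems
  field
    Θ Γₜ Γᵥ   : Env
    P R'      : Pos
    psₜ       : LamPrems t Θ R'
    Θ≈        : Θ ≈ₑ insertₑ k P Γₜ
    πᵥ        : Γᵥ ⊢ v ∶ P
    R≈        : R ≈ R'
    split     : Γ ≈ₑ (Γₜ ⊎ₑ padₑ k Γᵥ)
    sizes-add : n ≡ sizes psₜ + size πᵥ

antiSubst-unused : ∀ k {v Γ t Q} → Value v → (π : Γ ⊢ t ∶ Q) →
  AntiSubst k v (rename (punchIn k) t) Γ Q (size π)
antiSubst-unused k {Γ = Γ} val π with weaken k π | value-𝟎 val
... | πₜ , sₜ | πᵥ , sᵥ =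
  antiSubst Γ 0ₑ 𝟎 πₜ πᵥ split (sym (trans (cong₂ _+_ sₜ sᵥ) (+-identityʳ _)))
  where
  split : Γ ≈ₑ (Γ ⊎ₑ padₑ k 0ₑ)
  split n = ≈-sym (≈trans (⊎-congˡ (Γ n) (padₑ-0ₑ k n)) (⊎-identityʳ (Γ n)))

antiSubst-var : ∀ k x {v Γ Q} → Value v → (π : Γ ⊢ singleAt v k x ∶ Q) →
  AntiSubst k v (var x) Γ Q (size π)
antiSubst-var zero    zero    {Γ = Γ} {Q} val π = antiSubst 0ₑ Γ Q (ax (∷ₑ-0ₑ Q) ≈-refl) π ≈ₑ-refl refl
antiSubst-var zero    (suc x) val π = antiSubst-unused 0 val π
antiSubst-var (suc k) zero    val π = antiSubst-unused (suc k) val π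
antiSubst-var (suc k) (suc x) val π with strengthen 0 π
... | Γ' , Γ≈ , π' , s' with antiSubst-var k x val π'
... | antiSubst Γₜ Γᵥ P πₜ πᵥ split sz with weaken 0 πₜ
... | πₜ' , sₜ =
  antiSubst (𝟎 ∷ₑ Γₜ) Γᵥ P πₜ' πᵥ split' (trans (sym s') (trans sz (cong (_+ size πᵥ) (sym sₜ))))
  where
  split' : _ ≈ₑ ((𝟎 ∷ₑ Γₜ) ⊎ₑ padₑ (suc k) Γᵥ)
  split' zero    = Γ≈ zero
  split' (suc n) = ≈trans (Γ≈ (suc n)) (split n)

mutual
  antiSubstitution : ∀ k t {v Γ Q} → Value v → (π : Γ ⊢ subst (singleAt v k) t ∶ Q) →
    AntiSubst k v t Γ Q (size π)
  antiSubstitution k (var x) val π = antiSubst-var k x val π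
  antiSubstitution k (lam t) val (λr ps e q) with antiSubstitutionPrems k t val ps
  ... | antiSubstPrems Θ Γₜ Γᵥ P R' psₜ Θ≈ πᵥ R≈ split sz =
    antiSubst Γₜ Γᵥ P (λr psₜ (≈ₑ-sym Θ≈) (≈trans q R≈)) πᵥ (≈ₑ-trans e split) sz
  antiSubstitution k (app a b) {Γ = Γ} val (appr {Γ₁ = Γ₁} {Γ₂ = Γ₂} π₁ π₂ e)
    with antiSubstitution k a val π₁ | antiSubstitution k b val π₂
  ... | antiSubst Aₜ Aᵥ Pa πa πva splitᵃ szᵃ | antiSubst Bₜ Bᵥ Pb πb πvb splitᵇ szᵇ
    with value-⊎ val πva πvb
  ... | πᵥ , sᵥ =
    antiSubst (Aₜ ⊎ₑ Bₜ) (Aᵥ ⊎ₑ Bᵥ) (Pa ⊎ Pb) (appr πa πb (insertₑ-⊎ₑ k Pa Pb Aₜ Bₜ)) πᵥ split sizes-add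
    where
    split : Γ ≈ₑ ((Aₜ ⊎ₑ Bₜ) ⊎ₑ padₑ k (Aᵥ ⊎ₑ Bᵥ))
    split n = begin
      Γ n                                                   ≈⟨ e n ⟩
      Γ₁ n ⊎ Γ₂ n                                           ≈⟨ ⊎-cong (splitᵃ n) (splitᵇ n) ⟩
      (Aₜ n ⊎ padₑ k Aᵥ n) ⊎ (Bₜ n ⊎ padₑ k Bᵥ n)           ≈⟨ ⊎-interchange (Aₜ n) (padₑ k Aᵥ n) (Bₜ n) (padₑ k Bᵥ n) ⟩
      (Aₜ n ⊎ Bₜ n) ⊎ (padₑ k Aᵥ n ⊎ padₑ k Bᵥ n)           ≈⟨ ⊎-congˡ _ (≈-sym (padₑ-⊎ₑ k Aᵥ Bᵥ n)) ⟩
      (Aₜ n ⊎ Bₜ n) ⊎ padₑ k (Aᵥ ⊎ₑ Bᵥ) n                   ∎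
      where open SetoidReasoning ≈-setoid
    sizes-add : suc (size π₁ + size π₂) ≡ suc (size πa + size πb) + size πᵥ
    sizes-add = begin
      suc (size π₁ + size π₂)                               ≡⟨ cong suc (cong₂ _+_ szᵃ szᵇ) ⟩
      suc ((size πa + size πva) + (size πb + size πvb))     ≡⟨ cong suc (+-interchange (size πa) (size πva) (size πb) (size πvb)) ⟩
      suc ((size πa + size πb) + (size πva + size πvb))     ≡⟨ cong (suc (size πa + size πb) +_) (sym sᵥ) ⟩
      suc (size πa + size πb) + size πᵥ                     ∎
      where open ≡-Reasoning

  antiSubstitutionPrems : ∀ k t {v Γ R} → Value v → (ps : LamPrems (subst (singleAt v (suc k)) t) Γ R) →
    AntiSubstPrems k v t Γ R (sizes ps)
  antiSubstitutionPrems k t val pnil with value-𝟎 val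
  ... | πᵥ , sᵥ =
    antiSubstPrems 0ₑ 0ₑ 0ₑ 𝟎 𝟎 pnil (≈ₑ-sym (insertₑ-0ₑ k)) πᵥ ≈nil (≈ₑ-sym (padₑ-0ₑ k)) (sym sᵥ)
  antiSubstitutionPrems k t val (pcons {Γ = Γ} {Δ = Δ} {Q = Q} π ps)
    with antiSubstitution (suc k) t val π | antiSubstitutionPrems k t val ps
  ... | antiSubst G₁ D₁ P₁ πₜ πv₁ split₁ sz₁ | antiSubstPrems Θ G₂ D₂ P₂ R' psₜ Θ≈ πv₂ R≈ split₂ sz₂
    with value-⊎ val πv₁ πv₂
  ... | πᵥ , sᵥ =
    antiSubstPrems (insertₑ k P₁ (tailₑ G₁) ⊎ₑ Θ) (tailₑ G₁ ⊎ₑ G₂) (D₁ ⊎ₑ D₂) (P₁ ⊎ P₂) (⟨ G₁ 0 , Q ⟩∷ R')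
      (pcons πₜ psₜ)
      (≈ₑ-trans (⊎ₑ-cong ≈ₑ-refl Θ≈) (≈ₑ-sym (insertₑ-⊎ₑ k P₁ P₂ (tailₑ G₁) G₂)))
      πᵥ
      (≈cons (≈trans (split₁ 0) (⊎-identityʳ _)) ≈-refl R≈)
      split sizes-add
    where
    split : (Γ ⊎ₑ Δ) ≈ₑ ((tailₑ G₁ ⊎ₑ G₂) ⊎ₑ padₑ k (D₁ ⊎ₑ D₂))
    split n = begin
      Γ n ⊎ Δ n                                             ≈⟨ ⊎-cong (split₁ (suc n)) (split₂ n) ⟩
      (G₁ (suc n) ⊎ padₑ k D₁ n) ⊎ (G₂ n ⊎ padₑ k D₂ n)     ≈⟨ ⊎-interchange (G₁ (suc n)) (padₑ k D₁ n) (G₂ n) (padₑ k D₂ n) ⟩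
      (G₁ (suc n) ⊎ G₂ n) ⊎ (padₑ k D₁ n ⊎ padₑ k D₂ n)     ≈⟨ ⊎-congˡ _ (≈-sym (padₑ-⊎ₑ k D₁ D₂ n)) ⟩
      (G₁ (suc n) ⊎ G₂ n) ⊎ padₑ k (D₁ ⊎ₑ D₂) n             ∎
      where open SetoidReasoning ≈-setoid
    sizes-add : size π + sizes ps ≡ (size πₜ + sizes psₜ) + size πᵥ
    sizes-add = begin
      size π + sizes ps                                     ≡⟨ cong₂ _+_ sz₁ sz₂ ⟩
      (size πₜ + size πv₁) + (sizes psₜ + size πv₂)         ≡⟨ +-interchange (size πₜ) (size πv₁) (sizes psₜ) (size πv₂) ⟩
      (size πₜ + sizes psₜ) + (size πv₁ + size πv₂)         ≡⟨ cong (size πₜ + sizes psₜ +_) (sym sᵥ) ⟩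
      (size πₜ + sizes psₜ) + size πᵥ                       ∎
      where open ≡-Reasoning

ExpandsBy : (Term → Term → Set) → ℕ → Set
ExpandsBy R k = ∀ {t t' Γ Q} (π' : Γ ⊢ t' ∶ Q) → R t t' → Γ ⊢ t ∶ Q # k + size π'

↦βv-expandsBy : ExpandsBy _↦βv_ 1
↦βv-expandsBy π' (βv {t = s} val) with antiSubstitution 0 s val π'
... | antiSubst Γₜ Γᵥ P πₜ πᵥ split sz with lam-intro πₜ
... | πλ , sλ = appr πλ πᵥ split , cong suc (trans (cong (_+ size πᵥ) sλ) (sym sz))

↦σ-expandsBy : ExpandsBy _↦σ_ 0
↦σ-expandsBy {Γ = Γ} (appr {Γ₁ = Γ₁} {Γ₂ = Γ₂} π₁ π₂ e) σ₁
  with lam-inversion π₁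
... | appr {Γ₁ = Θ₁} {Γ₂ = Θ₂} ρ₁ ρ₂ e' , s₁ with strengthen 0 ρ₂
... | Θ₂' , Θ₂≈ , ρ₂' , s₂
  with lam-intro-tailₑ (≈trans (e' 0) (≈trans (⊎-congˡ (Θ₁ 0) (Θ₂≈ 0)) (⊎-identityʳ _))) ρ₁
... | πλ , sλ = appr (appr πλ π₂ ≈ₑ-refl) ρ₂' split , sizes-eq
  where
  split : Γ ≈ₑ ((tailₑ Θ₁ ⊎ₑ Γ₂) ⊎ₑ Θ₂')
  split n = begin
    Γ n                                       ≈⟨ e n ⟩
    Γ₁ n ⊎ Γ₂ n                               ≈⟨ ⊎-congʳ (Γ₂ n) (e' (suc n)) ⟩
    (Θ₁ (suc n) ⊎ Θ₂ (suc n)) ⊎ Γ₂ n          ≈⟨ ⊎-congʳ (Γ₂ n) (⊎-congˡ (Θ₁ (suc n)) (Θ₂≈ (suc n))) ⟩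
    (Θ₁ (suc n) ⊎ Θ₂' n) ⊎ Γ₂ n               ≈⟨ ⊎-swapʳ (Θ₁ (suc n)) (Θ₂' n) (Γ₂ n) ⟩
    (Θ₁ (suc n) ⊎ Γ₂ n) ⊎ Θ₂' n               ∎
    where open SetoidReasoning ≈-setoid
  sizes-eq : suc (suc (size πλ + size π₂) + size ρ₂') ≡ suc (size π₁ + size π₂)
  sizes-eq = begin
    suc (suc (size πλ + size π₂) + size ρ₂')  ≡⟨ cong₂ (λ m n → suc (suc (m + size π₂) + n)) sλ s₂ ⟩
    suc (suc (size ρ₁ + size π₂) + size ρ₂)   ≡⟨ rearrange (size ρ₁) (size ρ₂) (size π₂) ⟩
    suc (suc (size ρ₁ + size ρ₂) + size π₂)   ≡⟨ cong (λ m → suc (m + size π₂)) s₁ ⟩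
    suc (size π₁ + size π₂)                   ∎
    where
    open ≡-Reasoning
    rearrange : ∀ a b c → suc (suc (a + c) + b) ≡ suc (suc (a + b) + c)
    rearrange = solve-∀
↦σ-expandsBy {Γ = Γ} (appr {Γ₁ = Γ₁} {Γ₂ = Γ₂} π₁ π₂ e) (σ₃ _)
  with lam-inversion π₁
... | appr {Γ₁ = Θ₁} {Γ₂ = Θ₂} ρ₁ ρ₂ e' , s₁ with strengthen 0 ρ₁
... | Θ₁' , Θ₁≈ , ρ₁' , s₂ with lam-intro-tailₑ (≈trans (e' 0) (⊎-congʳ (Θ₂ 0) (Θ₁≈ 0))) ρ₂
... | πλ , sλ = appr ρ₁' (appr πλ π₂ ≈ₑ-refl) split , sizes-eq
  where
  split : Γ ≈ₑ (Θ₁' ⊎ₑ (tailₑ Θ₂ ⊎ₑ Γ₂))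
  split n = begin
    Γ n                                       ≈⟨ e n ⟩
    Γ₁ n ⊎ Γ₂ n                               ≈⟨ ⊎-congʳ (Γ₂ n) (e' (suc n)) ⟩
    (Θ₁ (suc n) ⊎ Θ₂ (suc n)) ⊎ Γ₂ n          ≈⟨ ⊎-congʳ (Γ₂ n) (⊎-congʳ (Θ₂ (suc n)) (Θ₁≈ (suc n))) ⟩
    (Θ₁' n ⊎ Θ₂ (suc n)) ⊎ Γ₂ n               ≈⟨ ⊎-assoc (Θ₁' n) (Θ₂ (suc n)) (Γ₂ n) ⟩
    Θ₁' n ⊎ (Θ₂ (suc n) ⊎ Γ₂ n)               ∎
    where open SetoidReasoning ≈-setoid
  sizes-eq : suc (size ρ₁' + suc (size πλ + size π₂)) ≡ suc (size π₁ + size π₂)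
  sizes-eq = begin
    suc (size ρ₁' + suc (size πλ + size π₂))  ≡⟨ cong₂ (λ m n → suc (m + suc (n + size π₂))) s₂ sλ ⟩
    suc (size ρ₁ + suc (size ρ₂ + size π₂))   ≡⟨ rearrange (size ρ₁) (size ρ₂) (size π₂) ⟩
    suc (suc (size ρ₁ + size ρ₂) + size π₂)   ≡⟨ cong (λ m → suc (m + size π₂)) s₁ ⟩
    suc (size π₁ + size π₂)                   ∎
    where
    open ≡-Reasoning
    rearrange : ∀ a b c → suc (a + suc (b + c)) ≡ suc (suc (a + b) + c)
    rearrange = solve-∀

+-suc-shiftˡ : ∀ k a b → suc ((k + a) + b) ≡ k + suc (a + b)
+-suc-shiftˡ = solve-∀

+-suc-shiftʳ : ∀ k a b → suc (a + (k + b)) ≡ k + suc (a + b)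
+-suc-shiftʳ = solve-∀

Bal-expandsBy : ∀ {R k} → ExpandsBy R k → ExpandsBy (Bal R) k
Bal-expandsBy expand π' (root r) = expand π' r
Bal-expandsBy {k = k} expand (appr π₁ π₂ e) (inLam st) with lam-inversion π₁
... | ρ , sρ with Bal-expandsBy expand ρ st
... | ρ' , sρ' with lam-intro ρ'
... | π₁' , s = appr π₁' π₂ e , trans (cong (λ n → suc (n + size π₂)) grown) (+-suc-shiftˡ k (size π₁) (size π₂))
  where
  grown : size π₁' ≡ k + size π₁
  grown = trans s (trans sρ' (cong (k +_) sρ))
Bal-expandsBy {k = k} expand (appr π₁ π₂ e) (appL st) with Bal-expandsBy expand π₁ st
... | π₁' , s = appr π₁' π₂ e , trans (cong (λ n → suc (n + size π₂)) s) (+-suc-shiftˡ k (size π₁) (size π₂))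
Bal-expandsBy {k = k} expand (appr π₁ π₂ e) (appR st) with Bal-expandsBy expand π₂ st
... | π₂' , s = appr π₁ π₂' e , trans (cong (λ n → suc (size π₁ + n)) s) (+-suc-shiftʳ k (size π₁) (size π₂))

size-pos-→σ : ∀ {t t' Γ Q} (π' : Γ ⊢ t' ∶ Q) → t →σ t' → 0 < size π'
size-pos-→σ (appr _ _ _) _        = s≤s z≤n
size-pos-→σ (ax _ _)     (root ())
size-pos-→σ (λr _ _ _)   (root ())

mainTheorem10 : ∀ {t t' : Term} {Γ : Env} {Q : Pos} (π' : Γ ⊢ t' ∶ Q) →
    (t →βv t' → Σ (Γ ⊢ t ∶ Q) (λ π → size π ≡ size π' + 1))
    × (t →σ t' → (0 < size π') × Σ (Γ ⊢ t ∶ Q) (λ π → size π ≡ size π'))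
mainTheorem10 π' =
  (λ st → map₂ (λ s → trans s (+-comm 1 (size π'))) (Bal-expandsBy ↦βv-expandsBy π' st)) ,
  (λ st → size-pos-→σ π' st , Bal-expandsBy ↦σ-expandsBy π' st)
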